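{- Let $G$ be the undirected graph and $\mathcal{P}$ the path family described in the context. Each path in $\mathcal{P}$ is the unique shortest path between its endpoints in $G$.
   Context: Let $n$ be divisible by $5$ and $m=n/5$. The undirected graph $G=(V,E,w)$ has vertices $v_i^1,\dots,v_i^5$ for $i=1,\dots,m$; the cycle $C_i$ consists of edges $\{v_i^1,v_i^2\},\{v_i^2,v_i^3\},\{v_i^3,v_i^4\},\{v_i^4,v_i^5\},\{v_i^5,v_i^1\}$. For every $i<m$ the cross-cycle edges are $\{v_i^1,v_{i+1}^1\},\{v_i^2,v_{i+1}^3\},\{v_i^3,v_{i+1}^5\},\{v_i^4,v_{i+1}^2\},\{v_i^5,v_{i+1}^4\}$. Every edge of $C_i$ has weight $1/3^i$; every cross-cycle edge has weight $1$. Superscripts are taken modulo $5$ in $\{1,\dots,5\}$. The family $\mathcal{P}$: for each $i<m$ and each vertex $v_i^k$, letting $v_{i+1}^j$ be the other endpoint of the cross-cycle edge at $v_i^k$ going to $C_{i+1}$, $\mathcal{P}$ contains the path $v_i^k, v_{i+1}^j, v_{i+1}^{j+1}, v_{i+1}^{j+2}$. -}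

module Defs where

open import Data.Nat as ℕ using (ℕ; zero; suc; _^_)
open import Data.Nat.Properties using (m^n≢0)
open import Data.Fin using (Fin; toℕ) renaming (zero to f0; suc to fs)
open import Data.Product using (_×_; _,_)
open import Data.Sum using (_⊎_; inj₁; inj₂)
open import Data.List using (List; []; _∷_)
open import Data.Integer using (+_)
open import Data.Rational using (ℚ; 0ℚ; 1ℚ; _+_; _/_)
open import Relation.Binary.PropositionalEquality using (_≡_)

-- Vertex v_i^k with i ∈ {1..m}, k ∈ {1..5} is encoded as (i-1 , k-1) : Fin m × Fin 5.
V : ℕ → Set
V m = Fin m × Fin 5

succ5 : Fin 5 → Fin 5
succ5 f0 = fs f0
succ5 (fs f0) = fs (fs f0)
succ5 (fs (fs f0)) = fs (fs (fs f0))
succ5 (fs (fs (fs f0))) = fs (fs (fs (fs f0)))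
succ5 (fs (fs (fs (fs f0)))) = f0

-- cross-cycle target superscript: 1↦1, 2↦3, 3↦5, 4↦2, 5↦4 (0-based: 0↦0,1↦2,2↦4,3↦1,4↦3)
cross : Fin 5 → Fin 5
cross f0 = f0
cross (fs f0) = fs (fs f0)
cross (fs (fs f0)) = fs (fs (fs (fs f0)))
cross (fs (fs (fs f0))) = fs f0
cross (fs (fs (fs (fs f0)))) = fs (fs (fs f0))

-- Directed presentation of the edge set of G (each undirected edge appears once).
data Edge (m : ℕ) : V m → V m → Set where
  cyc : (i : Fin m) (k : Fin 5) → Edge m (i , k) (i , succ5 k)
  crs : (i i' : Fin m) → toℕ i' ≡ suc (toℕ i) → (k : Fin 5) →
        Edge m (i , k) (i' , cross k)

-- weight 1/3^i for cycle edges of C_i (1-based i = toℕ i + 1), 1 for cross edges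
edgeW : ∀ {m u v} → Edge m u v → ℚ
edgeW (cyc i k) = (+ 1 / (3 ^ suc (toℕ i))) {{m^n≢0 3 (suc (toℕ i))}}
edgeW (crs i i' _ k) = 1ℚ

Adj : (m : ℕ) → V m → V m → Set
Adj m u v = Edge m u v ⊎ Edge m v u

adjW : ∀ {m u v} → Adj m u v → ℚ
adjW (inj₁ e) = edgeW e
adjW (inj₂ e) = edgeW e

data Walk (m : ℕ) : V m → V m → Set where
  []  : ∀ {u} → Walk m u u
  _∷_ : ∀ {u v w} → Adj m u v → Walk m v w → Walk m u w

infixr 5 _∷_

vertices : ∀ {m u v} → Walk m u v → List (V m)
vertices {u = u} [] = u ∷ []
vertices {u = u} (e ∷ p) = u ∷ vertices p

weight : ∀ {m u v} → Walk m u v → ℚ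
weight [] = 0ℚ
weight (e ∷ p) = adjW e + weight p

-- The path of the family 𝒫 starting at v_i^k:
-- v_i^k, v_{i+1}^j, v_{i+1}^{j+1}, v_{i+1}^{j+2} with j = cross k.
pathP : ∀ {m} (i i' : Fin m) (eq : toℕ i' ≡ suc (toℕ i)) (k : Fin 5) →
        Walk m (i , k) (i' , succ5 (succ5 (cross k)))
pathP i i' eq k =
  inj₁ (crs i i' eq k) ∷ inj₁ (cyc i' (cross k)) ∷ inj₁ (cyc i' (succ5 (cross k))) ∷ []

{-# OPTIONS --safe #-}
-- Write w_i = 1/3^i, so that 2 w_{i+1} < w_i ≤ 1/3 and the path costs 1 + 2 w_{i+1}.
-- A competing walk from v_i^k either starts along C_i, paying w_i > 2 w_{i+1}, and must
-- still pay at least 1 to reach another cycle; or it starts with a cross edge of cost 1.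
-- In the latter case the rest costs more than 2 w_{i+1}: it either pays another 1 for a
-- cross edge, or it stays on C_{i+1} going from position j to j + 2, and on a 5-cycle
-- the only way to do this in two steps is j, j + 1, j + 2.
module Submission where

open import Defs
open import Data.Nat using (ℕ; suc)
open import Data.Fin using (Fin; toℕ)
open import Data.Product using (_×_; _,_)
open import Data.List.Relation.Unary.Unique.Propositional using (Unique)
open import Data.Rational using (_<_)
open import Relation.Binary.PropositionalEquality using (_≡_; _≢_)

open import Data.Nat as ℕ using (_^_)
import Data.Nat.Properties as ℕ
open import Data.Nat.Tactic.RingSolver using (solve-∀)
open import Data.Integer as ℤ using (+_)
import Data.Integer.Properties as ℤ
open import Data.Rational using (ℚ; 0ℚ; 1ℚ; _+_; _/_; _≤_; ↥_; ↧_; toℚᵘ)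
open import Data.Rational.Properties
  using (↥-/; ↧-/; toℚᵘ-cancel-<; toℚᵘ-homo-+; positive⁻¹; normalize-pos;
         ≤-refl; ≤-trans; <⇒≤; <-≤-trans; <-trans; +-monoʳ-≤; +-monoʳ-<;
         +-identityʳ; +-comm; module ≤-Reasoning)
import Data.Rational.Unnormalised as ℚᵘ
import Data.Rational.Unnormalised.Properties as ℚᵘ
open import Data.Fin using (_≟_)
open import Data.Fin.Properties using (all?; toℕ-injective)
open import Data.Product using (proj₁; proj₂)
open import Data.Sum using (_⊎_; inj₁; inj₂)
open import Data.Empty using (⊥-elim)
open import Data.List as List using (List)
import Data.List.Relation.Unary.All as All
import Data.List.Relation.Unary.AllPairs as AllPairs
open import Function using (_∘_)
open import Relation.Nullary.Decidable using (from-yes; ¬?; _⊎-dec_; _→-dec_)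
open import Relation.Binary.PropositionalEquality
  using (refl; sym; trans; cong; cong₂; subst; module ≡-Reasoning)

toℚᵘ-/ : ∀ i n .{{_ : ℕ.NonZero n}} → toℚᵘ (i / n) ℚᵘ.≃ (i ℚᵘ./ n)
toℚᵘ-/ i n@(suc _) = cancel-gcd (i / n) (↥-/ i n) (↧-/ i n)
  where
  open ≡-Reasoning
  cancel-gcd : ∀ p {g} → ↥ p ℤ.* g ≡ i → ↧ p ℤ.* g ≡ + n → toℚᵘ p ℚᵘ.≃ (i ℚᵘ./ n)
  cancel-gcd p@record{} {g} ↥p*g≡i ↧p*g≡n = ℚᵘ.*≡* (begin
    ↥ p ℤ.* + n              ≡⟨ cong (↥ p ℤ.*_) ↧p*g≡n ⟨
    ↥ p ℤ.* (↧ p ℤ.* g)      ≡⟨ cong (↥ p ℤ.*_) (ℤ.*-comm (↧ p) g) ⟩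
    ↥ p ℤ.* (g ℤ.* ↧ p)      ≡⟨ ℤ.*-assoc (↥ p) g (↧ p) ⟨
    ↥ p ℤ.* g ℤ.* ↧ p        ≡⟨ cong (ℤ._* ↧ p) ↥p*g≡i ⟩
    i ℤ.* ↧ p                ∎)

-- Cross-multiplying the unnormalised fractions 1/n + 1/n = (1·n + 1·n)/(n·n) and 1/m.
1/n+1/n<1/m-cross-multiplied : ∀ {m n} .{{_ : ℕ.NonZero n}} → 2 ℕ.* m ℕ.< n →
                               (1 ℕ.* n ℕ.+ 1 ℕ.* n) ℕ.* m ℕ.< 1 ℕ.* (n ℕ.* n)
1/n+1/n<1/m-cross-multiplied {m} {n} 2m<n = begin-strict
  (1 ℕ.* n ℕ.+ 1 ℕ.* n) ℕ.* m   ≡⟨ cong (λ k → (k ℕ.+ k) ℕ.* m) (ℕ.*-identityˡ n) ⟩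
  (n ℕ.+ n) ℕ.* m               ≡⟨ regroup n m ⟩
  n ℕ.* (2 ℕ.* m)               <⟨ ℕ.*-monoʳ-< n 2m<n ⟩
  n ℕ.* n                       ≡⟨ ℕ.*-identityˡ (n ℕ.* n) ⟨
  1 ℕ.* (n ℕ.* n)               ∎
  where
  open ℕ.≤-Reasoning
  regroup : ∀ n m → (n ℕ.+ n) ℕ.* m ≡ n ℕ.* (2 ℕ.* m)
  regroup = solve-∀

1/n+1/n<1/m : ∀ m n .{{_ : ℕ.NonZero m}} .{{_ : ℕ.NonZero n}} →
              2 ℕ.* m ℕ.< n → + 1 / n + + 1 / n < + 1 / m
1/n+1/n<1/m m@(suc _) n@(suc _) 2m<n = toℚᵘ-cancel-< (begin-strict
  toℚᵘ (+ 1 / n + + 1 / n)                 ≃⟨ toℚᵘ-homo-+ (+ 1 / n) (+ 1 / n) ⟩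
  toℚᵘ (+ 1 / n) ℚᵘ.+ toℚᵘ (+ 1 / n)       ≃⟨ ℚᵘ.+-cong (toℚᵘ-/ (+ 1) n) (toℚᵘ-/ (+ 1) n) ⟩
  + 1 ℚᵘ./ n ℚᵘ.+ + 1 ℚᵘ./ n               <⟨ ℚᵘ.*<* (ℤ.+<+ (1/n+1/n<1/m-cross-multiplied 2m<n)) ⟩
  + 1 ℚᵘ./ m                               ≃⟨ toℚᵘ-/ (+ 1) m ⟨
  toℚᵘ (+ 1 / m)                           ∎)
  where
  open ℚᵘ.≤-Reasoning

p≤p+q : ∀ {p q} → 0ℚ ≤ q → p ≤ p + q
p≤p+q {p} {q} 0≤q = subst (_≤ p + q) (+-identityʳ p) (+-monoʳ-≤ p 0≤q)

q≤p+q : ∀ {p q} → 0ℚ ≤ p → q ≤ p + q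
q≤p+q {p} {q} 0≤p = subst (q ≤_) (+-comm q p) (p≤p+q 0≤p)

p<p+q : ∀ {p q} → 0ℚ < q → p < p + q
p<p+q {p} {q} 0<q = subst (_< p + q) (+-identityʳ p) (+-monoʳ-< p 0<q)

-- w n is the weight of the edges of C_{n+1}: cycles are indexed from 0 by Fin m.
w : ℕ → ℚ
w n = (+ 1 / 3 ^ suc n) {{ℕ.m^n≢0 3 (suc n)}}

w-pos : ∀ n → 0ℚ < w n
w-pos n = positive⁻¹ (w n) {{normalize-pos 1 (3 ^ suc n) {{ℕ.m^n≢0 3 (suc n)}}}}

w+w<1 : ∀ n → w n + w n < 1ℚ
w+w<1 n = 1/n+1/n<1/m 1 (3 ^ suc n) {{_}} {{ℕ.m^n≢0 3 (suc n)}}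
  (ℕ.*-mono-≤ (ℕ.≤-refl {3}) (ℕ.m^n>0 3 n))

w[1+n]+w[1+n]<w[n] : ∀ n → w (suc n) + w (suc n) < w n
w[1+n]+w[1+n]<w[n] n =
  1/n+1/n<1/m (3 ^ suc n) (3 ^ suc (suc n)) {{ℕ.m^n≢0 3 (suc n)}} {{ℕ.m^n≢0 3 (suc (suc n))}}
  (ℕ.*-monoˡ-< (3 ^ suc n) {{ℕ.m^n≢0 3 (suc n)}} {2} {3} ℕ.≤-refl)

w<1 : ∀ n → w n < 1ℚ
w<1 n = <-trans (p<p+q (w-pos n)) (w+w<1 n)

Neighbour : Fin 5 → Fin 5 → Set
Neighbour x y = y ≡ succ5 x ⊎ x ≡ succ5 y

succ5-no-fixpoint : ∀ c → c ≢ succ5 c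
succ5-no-fixpoint = from-yes (all? λ c → ¬? (c ≟ succ5 c))

succ5²-no-fixpoint : ∀ c → c ≢ succ5 (succ5 c)
succ5²-no-fixpoint = from-yes (all? λ c → ¬? (c ≟ succ5 (succ5 c)))

neighbour-not-two-ahead : ∀ c y → Neighbour c y → y ≢ succ5 (succ5 c)
neighbour-not-two-ahead = from-yes (all? λ c → all? λ y →
  (y ≟ succ5 c ⊎-dec c ≟ succ5 y) →-dec ¬? (y ≟ succ5 (succ5 c)))

two-ahead-via-succ5 : ∀ c y z → Neighbour c y → Neighbour y z → z ≡ succ5 (succ5 c) → y ≡ succ5 c
two-ahead-via-succ5 = from-yes (all? λ c → all? λ y → all? λ z →
  (y ≟ succ5 c ⊎-dec c ≟ succ5 y) →-dec (z ≟ succ5 y ⊎-dec y ≟ succ5 z) →-dec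
  z ≟ succ5 (succ5 c) →-dec y ≟ succ5 c)

next⇒≢ : ∀ {m} {i i' : Fin m} → toℕ i' ≡ suc (toℕ i) → i ≢ i'
next⇒≢ eq refl = ℕ.1+n≢n (sym eq)

next-of-next⇒≢ : ∀ {m} {j i i' : Fin m} → toℕ i ≡ suc (toℕ j) → toℕ i' ≡ suc (toℕ i) → j ≢ i'
next-of-next⇒≢ eq eq' refl = ℕ.<-asym (ℕ.≤-reflexive (sym eq)) (ℕ.≤-reflexive (sym eq'))

next-unique : ∀ {m} {i j j' : Fin m} → toℕ j ≡ suc (toℕ i) → toℕ j' ≡ suc (toℕ i) → j ≡ j'
next-unique eq eq' = toℕ-injective (trans eq (sym eq'))

arc : ∀ {m} → Fin m → Fin 5 → List (V m)
arc j c = (j , c) List.∷ (j , succ5 c) List.∷ (j , succ5 (succ5 c)) List.∷ List.[]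

module _ {m : ℕ} where

  data Out (j : Fin m) (x : Fin 5) : V m → ℚ → Set where
    along : ∀ {y} → Neighbour x y → Out j x (j , y) (w (toℕ j))
    up    : ∀ {j'} → toℕ j' ≡ suc (toℕ j) → Out j x (j' , cross x) 1ℚ
    down  : ∀ {j' y} → toℕ j ≡ suc (toℕ j') → Out j x (j' , y) 1ℚ

  out : ∀ {j x v} (e : Adj m (j , x) v) → Out j x v (adjW e)
  out (inj₁ (cyc j x))      = along (inj₁ refl)
  out (inj₂ (cyc j y))      = along (inj₂ refl)
  out (inj₁ (crs _ _ eq _)) = up eq
  out (inj₂ (crs _ _ eq _)) = down eq

  adjW-pos : ∀ {u v} (e : Adj m u v) → 0ℚ < adjW e
  adjW-pos (inj₁ (cyc j _))     = w-pos (toℕ j)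
  adjW-pos (inj₂ (cyc j _))     = w-pos (toℕ j)
  adjW-pos (inj₁ (crs _ _ _ _)) = positive⁻¹ 1ℚ
  adjW-pos (inj₂ (crs _ _ _ _)) = positive⁻¹ 1ℚ

  weight-nonneg : ∀ {u v} (Q : Walk m u v) → 0ℚ ≤ weight Q
  weight-nonneg []      = ≤-refl
  weight-nonneg (e ∷ Q) = ≤-trans (weight-nonneg Q) (q≤p+q (<⇒≤ (adjW-pos e)))

  weight-∷-pos : ∀ {u v t} (e : Adj m u v) (Q : Walk m v t) → 0ℚ < weight (e ∷ Q)
  weight-∷-pos e Q = <-≤-trans (adjW-pos e) (p≤p+q (weight-nonneg Q))

  1≤weight-between-cycles : ∀ {j x j' y} → j ≢ j' → (Q : Walk m (j , x) (j' , y)) → 1ℚ ≤ weight Q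
  1≤weight-between-cycles j≢j' [] = ⊥-elim (j≢j' refl)
  1≤weight-between-cycles {j} j≢j' (e ∷ Q) with adjW e | out e
  ... | _ | along _ = ≤-trans (1≤weight-between-cycles j≢j' Q) (q≤p+q (<⇒≤ (w-pos (toℕ j))))
  ... | _ | up _    = p≤p+q (weight-nonneg Q)
  ... | _ | down _  = p≤p+q (weight-nonneg Q)

  0<weight-after-two-steps : ∀ {j c y y₂ z} → Neighbour c y → Neighbour y y₂ →
                             (Q : Walk m (j , y₂) (j , z)) → z ≡ succ5 (succ5 c) →
                             (j , y) List.∷ vertices Q ≢
                               (j , succ5 c) List.∷ (j , succ5 (succ5 c)) List.∷ List.[] →
                             0ℚ < weight Q
  0<weight-after-two-steps {j} {c} {y} {z = z} c∼y y∼z [] z≡ ≢arc =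
    ⊥-elim (≢arc (cong₂ (λ a b → (j , a) List.∷ (j , b) List.∷ List.[])
                        (two-ahead-via-succ5 c y z c∼y y∼z z≡) z≡))
  0<weight-after-two-steps _ _ (e ∷ Q) _ _ = weight-∷-pos e Q

  w<weight-after-one-step : ∀ {j c y z} → Neighbour c y → (Q : Walk m (j , y) (j , z)) →
                            z ≡ succ5 (succ5 c) →
                            vertices Q ≢ (j , succ5 c) List.∷ (j , succ5 (succ5 c)) List.∷ List.[] →
                            w (toℕ j) < weight Q
  w<weight-after-one-step {c = c} {z = z} c∼z [] z≡ _ = ⊥-elim (neighbour-not-two-ahead c z c∼z z≡)
  w<weight-after-one-step {j} c∼y (e ∷ Q) z≡ ≢arc with adjW e | out e
  ... | _ | along y∼y₂ = p<p+q (0<weight-after-two-steps c∼y y∼y₂ Q z≡ ≢arc)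
  ... | _ | up _       = <-≤-trans (w<1 (toℕ j)) (p≤p+q (weight-nonneg Q))
  ... | _ | down _     = <-≤-trans (w<1 (toℕ j)) (p≤p+q (weight-nonneg Q))

  w+w<weight-detour : ∀ {j c z} (Q : Walk m (j , c) (j , z)) → z ≡ succ5 (succ5 c) →
                      vertices Q ≢ arc j c → w (toℕ j) + w (toℕ j) < weight Q
  w+w<weight-detour {c = c} [] z≡ _ = ⊥-elim (succ5²-no-fixpoint c z≡)
  w+w<weight-detour {j} {c} (e ∷ Q) z≡ ≢arc with adjW e | out e
  ... | _ | along c∼y =
    +-monoʳ-< (w (toℕ j)) (w<weight-after-one-step c∼y Q z≡ (≢arc ∘ cong ((j , c) List.∷_)))
  ... | _ | up _      = <-≤-trans (w+w<1 (toℕ j)) (p≤p+q (weight-nonneg Q))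
  ... | _ | down _    = <-≤-trans (w+w<1 (toℕ j)) (p≤p+q (weight-nonneg Q))

  1+w+w<weight : ∀ {i i' z} (eq : toℕ i' ≡ suc (toℕ i)) k (Q : Walk m (i , k) (i' , z)) →
                 z ≡ succ5 (succ5 (cross k)) → vertices Q ≢ (i , k) List.∷ arc i' (cross k) →
                 1ℚ + (w (toℕ i') + w (toℕ i')) < weight Q
  1+w+w<weight eq k [] _ _ = ⊥-elim (next⇒≢ eq refl)
  1+w+w<weight {i} {i'} eq k (e ∷ Q) z≡ ≢P with adjW e | out e
  ... | _ | along _ = begin-strict
    1ℚ + (w (toℕ i') + w (toℕ i'))  <⟨ +-monoʳ-< 1ℚ w[i']+w[i']<w[i] ⟩
    1ℚ + w (toℕ i)                  ≡⟨ +-comm 1ℚ (w (toℕ i)) ⟩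
    w (toℕ i) + 1ℚ                  ≤⟨ +-monoʳ-≤ (w (toℕ i)) (1≤weight-between-cycles (next⇒≢ eq) Q) ⟩
    w (toℕ i) + weight Q            ∎
    where
    open ≤-Reasoning
    w[i']+w[i']<w[i] : w (toℕ i') + w (toℕ i') < w (toℕ i)
    w[i']+w[i']<w[i] = subst (λ n → w n + w n < w (toℕ i)) (sym eq) (w[1+n]+w[1+n]<w[n] (toℕ i))
  ... | _ | up eq' with next-unique eq' eq
  ...   | refl = +-monoʳ-< 1ℚ (w+w<weight-detour Q z≡ (≢P ∘ cong ((i , k) List.∷_)))
  1+w+w<weight {i' = i'} eq k (e ∷ Q) z≡ ≢P | _ | down eq' =
    +-monoʳ-< 1ℚ (<-≤-trans (w+w<1 (toℕ i')) (1≤weight-between-cycles (next-of-next⇒≢ eq' eq) Q))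

arc-unique : ∀ {m} (j : Fin m) c → Unique (arc j c)
arc-unique j c = (distinct (succ5-no-fixpoint c) All.∷ distinct (succ5²-no-fixpoint c) All.∷ All.[])
          AllPairs.∷ (distinct (succ5-no-fixpoint (succ5 c)) All.∷ All.[])
          AllPairs.∷ All.[] AllPairs.∷ AllPairs.[]
  where
  distinct : ∀ {x y} → x ≢ y → (j , x) ≢ (j , y)
  distinct x≢y = x≢y ∘ cong proj₂

lemma3p1 : (m : ℕ) (i i' : Fin m) (eq : toℕ i' ≡ suc (toℕ i)) (k : Fin 5) →
    Unique (vertices (pathP i i' eq k)) ×
    ((Q : Walk m (i , k) (i' , succ5 (succ5 (cross k)))) →
      Unique (vertices Q) →
      vertices Q ≢ vertices (pathP i i' eq k) →
      weight (pathP i i' eq k) < weight Q)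
lemma3p1 m i i' eq k =
  (off-cycle All.∷ off-cycle All.∷ off-cycle All.∷ All.[]) AllPairs.∷ arc-unique i' (cross k) ,
  lightest
  where
  off-cycle : ∀ {c} → (i , k) ≢ (i' , c)
  off-cycle = next⇒≢ eq ∘ cong proj₁
  lightest : (Q : Walk m (i , k) (i' , succ5 (succ5 (cross k)))) → Unique (vertices Q) →
             vertices Q ≢ vertices (pathP i i' eq k) → weight (pathP i i' eq k) < weight Q
  lightest Q _ ≢P = subst (_< weight Q) (cong (λ x → 1ℚ + (w (toℕ i') + x)) (sym (+-identityʳ _)))
                          (1+w+w<weight eq k Q refl ≢P)
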